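{- Let $f:\{ -1,1\}^n\to\{ -1,1\}$ be $\mathrm{opt}_s$-close to a size-$s$ decision tree $T$. Then for all $p\in(0,1)$, $\mathrm{NS}_p(f)\le p\log s+2\,\mathrm{opt}_s$.
   Context: Uniform distribution on $\{ -1,1\}^n$; size of a decision tree = number of leaves; $\mathrm{opt}_s$-close means $\Pr[f(\mathbf{x})\ne T(\mathbf{x})]\le\mathrm{opt}_s$. For $\mathbf{x}$ uniform, a $p$-noisy copy $\mathbf{y}$ is obtained by independently rerandomizing each coordinate of $\mathbf{x}$ with probability $p$, and $\mathrm{NS}_p(f)=\Pr[f(\mathbf{x})\ne f(\mathbf{y})]$. Logarithms are base 2.
   Formalization: The noise rate p ranges over the rationals in (0,1), and the closeness parameter $\mathrm{opt}_s$ is taken to be rational. -}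

module Defs where

open import Data.Bool using (Bool; true; false; if_then_else_; _xor_)
open import Data.Nat as ℕ using (ℕ; zero; suc)
open import Data.Integer as ℤ using (+_; ∣_∣)
open import Data.Fin using (Fin)
open import Data.Vec using (Vec; []; _∷_; lookup)
open import Data.List using (List; []; _∷_; map; concatMap; foldr)
open import Data.Rational as ℚ using (ℚ; 0ℚ; 1ℚ; ½; _+_; _*_; _-_; _≤_; ↥_; ↧ₙ_)
open import Data.Product using (∃; _×_)
open import Data.Sum using (_⊎_)
open import Relation.Binary.PropositionalEquality using (_≡_)

-- A point of {-1,1}^n, encoded with Bool (true ↔ -1, false ↔ 1, say).
Cube : ℕ → Set
Cube n = Vec Bool n

allPoints : (n : ℕ) → List (Cube n)
allPoints zero = [] ∷ []
allPoints (suc n) = concatMap (λ v → (false ∷ v) ∷ (true ∷ v) ∷ []) (allPoints n)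

data DTree (n : ℕ) : Set where
  leaf : Bool → DTree n
  node : Fin n → DTree n → DTree n → DTree n

evalDT : ∀ {n} → DTree n → Cube n → Bool
evalDT (leaf b) x = b
evalDT (node i t₀ t₁) x = if lookup x i then evalDT t₁ x else evalDT t₀ x

size : ∀ {n} → DTree n → ℕ
size (leaf _) = 1
size (node _ t₀ t₁) = size t₀ ℕ.+ size t₁

sumℚ : List ℚ → ℚ
sumℚ = foldr _+_ 0ℚ

_^ℚ_ : ℚ → ℕ → ℚ
q ^ℚ zero = 1ℚ
q ^ℚ suc k = q * (q ^ℚ k)

𝟙 : Bool → ℚ
𝟙 b = if b then 1ℚ else 0ℚ

𝔼 : (n : ℕ) → (Cube n → ℚ) → ℚ
𝔼 n g = sumℚ (map (λ x → g x * (½ ^ℚ n)) (allPoints n))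

dist : ∀ {n} → (Cube n → Bool) → (Cube n → Bool) → ℚ
dist {n} f g = 𝔼 n (λ x → 𝟙 (f x xor g x))

-- Probability that the rerandomisation pattern is R (R_i = true iff
-- coordinate i is rerandomised, independently with probability p).
patternWeight : ∀ {n} → ℚ → Vec Bool n → ℚ
patternWeight p [] = 1ℚ
patternWeight p (r ∷ R) = (if r then p else 1ℚ - p) * patternWeight p R

rerandomise : ∀ {n} → Vec Bool n → Cube n → Cube n → Cube n
rerandomise [] [] [] = []
rerandomise (r ∷ R) (x ∷ xs) (z ∷ zs) = (if r then z else x) ∷ rerandomise R xs zs

NS : ∀ {n} → ℚ → (Cube n → Bool) → ℚ
NS {n} p f =
  𝔼 n (λ x → sumℚ (map (λ R → patternWeight p R *
     𝔼 n (λ z → 𝟙 (f x xor f (rerandomise R x z)))) (allPoints n)))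

-- a ≤ p · log₂ s  (for rational a, rational p > 0, natural s ≥ 1), stated
-- exactly via exponentiation: either a ≤ 0, or a = a'/d > 0, p = pn/pd, and
-- 2^(a'·pd) ≤ s^(d·pn), i.e. 2^(a/p) ≤ s.
_≤_·log₂_ : ℚ → ℚ → ℕ → Set
a ≤ p ·log₂ s =
  (a ≤ 0ℚ) ⊎
  (∃ λ (a' : ℕ) → (↥ a ≡ + a') × (2 ℕ.^ (a' ℕ.* ↧ₙ p) ℕ.≤ s ℕ.^ (↧ₙ a ℕ.* ∣ ↥ p ∣)))

-- If f(x) ≠ f(y) then f(x) ≠ T(x), T(x) ≠ T(y) or T(y) ≠ f(y); since a p-noisy copy y of a uniform
-- x is again uniform, NS_p(f) ≤ 2 Pr[f ≠ T] + NS_p(T). The leaves of T cut the cube into subcubes,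
-- and T(x) ≠ T(y) forces the noise to rerandomise one of the k coordinates fixed by the leaf of x,
-- which happens with expected count p k; a leaf fixing k coordinates has probability 2^(-k), so
-- NS_p(T) ≤ p Σ_leaves 2^(-k) k. The entropy bound Σ_leaves 2^(-k) k ≤ log₂ s is proved in the
-- exponentiated form 2^(Σ_x depth(x)) ≤ s^(2^n), by induction on T using 4ab ≤ (a + b)² at
-- each node.

module Submission where

open import Defs
open import Algebra.Bundles using (CommutativeMonoid)
import Algebra.Properties.CommutativeSemigroup as CommSemigroupProperties
open import Data.Bool using (Bool; true; false; if_then_else_; _xor_)
open import Data.Bool.Properties using (xor-same; xor-comm)
open import Data.Fin using (Fin; zero; suc)
import Data.Integer as ℤ
import Data.Integer.Properties as ℤP
open import Data.List using (List; []; _∷_; map; _++_; concatMap)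
open import Data.List.Properties using (map-++)
open import Data.List.Membership.Propositional using (_∈_; find)
open import Data.List.Relation.Unary.All as All using (All; []; _∷_)
open import Data.List.Relation.Unary.All.Properties using (++⁺)
open import Data.List.Relation.Unary.Any using (Any; here; there)
open import Data.List.Relation.Unary.Any.Properties using (++⁺ˡ; ++⁺ʳ)
open import Data.Maybe using (Maybe; just; nothing)
open import Data.Nat as ℕ using (ℕ; zero; suc)
import Data.Nat.Properties as ℕP
open import Data.Nat.ListAction using (sum)
open import Data.Nat.ListAction.Properties using (sum-++)
open import Data.Nat.Tactic.RingSolver using (solve-∀)
open import Data.Product using (_×_; _,_; proj₁; proj₂; ∃)
open import Data.Rational as ℚ using (ℚ; mkℚ; 0ℚ; 1ℚ; ½; _+_; _*_; _-_; _≤_; _<_; ↥_; ↧ₙ_)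
import Data.Rational.Properties as ℚP
open import Data.Rational.Literals using (fromℤ)
open import Data.Rational.Solver using (module +-*-Solver)
import Data.Rational.Unnormalised as ℚᵘ
import Data.Rational.Unnormalised.Properties as ℚᵘP
open import Data.Sum using (inj₁; inj₂)
open import Data.Vec using (Vec; []; _∷_; lookup; replicate; _[_]≔_)
open import Data.Vec.Properties using (lookup∘update)
open import Relation.Binary.PropositionalEquality
open import Relation.Nullary using (yes; no; contradiction)
open +-*-Solver using (solve; _:+_; _:*_; _:-_; _:=_; con)

module + = CommSemigroupProperties (CommutativeMonoid.commutativeSemigroup ℚP.+-0-commutativeMonoid)
module * = CommSemigroupProperties (CommutativeMonoid.commutativeSemigroup ℚP.*-1-commutativeMonoid)
module ℕ* = CommSemigroupProperties ℕP.*-commutativeSemigroup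

∑ : {A : Set} → List A → (A → ℚ) → ℚ
∑ xs h = sumℚ (map h xs)

module _ {A : Set} where

  ∑-cong : (xs : List A) {g h : A → ℚ} → (∀ x → g x ≡ h x) → ∑ xs g ≡ ∑ xs h
  ∑-cong []       g≡h = refl
  ∑-cong (x ∷ xs) g≡h = cong₂ _+_ (g≡h x) (∑-cong xs g≡h)

  ∑-+ : (xs : List A) (g h : A → ℚ) → ∑ xs (λ x → g x + h x) ≡ ∑ xs g + ∑ xs h
  ∑-+ []       g h = refl
  ∑-+ (x ∷ xs) g h = begin
    (g x + h x) + ∑ xs (λ x → g x + h x) ≡⟨ cong ((g x + h x) +_) (∑-+ xs g h) ⟩
    (g x + h x) + (∑ xs g + ∑ xs h)      ≡⟨ +.interchange (g x) (h x) (∑ xs g) (∑ xs h) ⟩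
    (g x + ∑ xs g) + (h x + ∑ xs h)      ∎
    where open ≡-Reasoning

  ∑-*ˡ : (xs : List A) (c : ℚ) (g : A → ℚ) → ∑ xs (λ x → c * g x) ≡ c * ∑ xs g
  ∑-*ˡ []       c g = sym (ℚP.*-zeroʳ c)
  ∑-*ˡ (x ∷ xs) c g = trans (cong (c * g x +_) (∑-*ˡ xs c g)) (sym (ℚP.*-distribˡ-+ c (g x) _))

  ∑-*ʳ : (xs : List A) (g : A → ℚ) (c : ℚ) → ∑ xs (λ x → g x * c) ≡ ∑ xs g * c
  ∑-*ʳ xs g c = begin
    ∑ xs (λ x → g x * c) ≡⟨ ∑-cong xs (λ x → ℚP.*-comm (g x) c) ⟩
    ∑ xs (λ x → c * g x) ≡⟨ ∑-*ˡ xs c g ⟩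
    c * ∑ xs g           ≡⟨ ℚP.*-comm c (∑ xs g) ⟩
    ∑ xs g * c           ∎
    where open ≡-Reasoning

  ∑-mono-≤ : (xs : List A) {g h : A → ℚ} → (∀ x → g x ≤ h x) → ∑ xs g ≤ ∑ xs h
  ∑-mono-≤ []       g≤h = ℚP.≤-refl
  ∑-mono-≤ (x ∷ xs) g≤h = ℚP.+-mono-≤ (g≤h x) (∑-mono-≤ xs g≤h)

  ∑-nonNeg : (xs : List A) {h : A → ℚ} → (∀ x → 0ℚ ≤ h x) → 0ℚ ≤ ∑ xs h
  ∑-nonNeg []       h≥0 = ℚP.≤-refl
  ∑-nonNeg (x ∷ xs) h≥0 = ℚP.+-mono-≤ (h≥0 x) (∑-nonNeg xs h≥0)

  ∈⇒≤∑ : {xs : List A} {h : A → ℚ} → (∀ x → 0ℚ ≤ h x) → ∀ {x} → x ∈ xs → h x ≤ ∑ xs h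
  ∈⇒≤∑ {x ∷ xs} {h} h≥0 (here refl) = begin
    h x          ≡⟨ ℚP.+-identityʳ (h x) ⟨
    h x + 0ℚ     ≤⟨ ℚP.+-monoʳ-≤ (h x) (∑-nonNeg xs h≥0) ⟩
    h x + ∑ xs h ∎
    where open ℚP.≤-Reasoning
  ∈⇒≤∑ {y ∷ xs} {h} h≥0 {x} (there x∈xs) = begin
    h x          ≡⟨ ℚP.+-identityˡ (h x) ⟨
    0ℚ + h x     ≤⟨ ℚP.+-mono-≤ (h≥0 y) (∈⇒≤∑ h≥0 x∈xs) ⟩
    h y + ∑ xs h ∎
    where open ℚP.≤-Reasoning

fromℕ : ℕ → ℚ
fromℕ m = fromℤ (ℤ.+ m)

fromℕ-+ : ∀ a b → fromℕ (a ℕ.+ b) ≡ fromℕ a + fromℕ b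
fromℕ-+ a b = ℚP.toℚᵘ-injective (ℚᵘP.≃-trans (ℚᵘ.*≡* eq) (ℚᵘP.≃-sym (ℚP.toℚᵘ-homo-+ (fromℕ a) (fromℕ b))))
  where
  eq : ℤ.+ (a ℕ.+ b) ℤ.* ℤ.+ 1 ≡ (ℤ.+ a ℤ.* ℤ.+ 1 ℤ.+ ℤ.+ b ℤ.* ℤ.+ 1) ℤ.* ℤ.+ 1
  eq rewrite ℤP.*-identityʳ (ℤ.+ a) | ℤP.*-identityʳ (ℤ.+ b) = cong (ℤ._* ℤ.+ 1) (ℤP.pos-+ a b)

fromℕ-* : ∀ a b → fromℕ (a ℕ.* b) ≡ fromℕ a * fromℕ b
fromℕ-* a b = ℚP.toℚᵘ-injective (ℚᵘP.≃-trans (ℚᵘ.*≡* eq) (ℚᵘP.≃-sym (ℚP.toℚᵘ-homo-* (fromℕ a) (fromℕ b))))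
  where
  eq : ℤ.+ (a ℕ.* b) ℤ.* ℤ.+ 1 ≡ (ℤ.+ a ℤ.* ℤ.+ b) ℤ.* ℤ.+ 1
  eq = cong (ℤ._* ℤ.+ 1) (ℤP.pos-* a b)

fromℕ-cancel-≤ : ∀ {a b} → fromℕ a ≤ fromℕ b → a ℕ.≤ b
fromℕ-cancel-≤ {a} {b} (ℚ.*≤* a≤b) = ℤ.drop‿+≤+ (subst₂ ℤ._≤_ (ℤP.*-identityʳ (ℤ.+ a)) (ℤP.*-identityʳ (ℤ.+ b)) a≤b)

fromℕ-mono-≤ : ∀ {a b} → a ℕ.≤ b → fromℕ a ≤ fromℕ b
fromℕ-mono-≤ {a} {b} a≤b = ℚ.*≤* (subst₂ ℤ._≤_ (sym (ℤP.*-identityʳ (ℤ.+ a))) (sym (ℤP.*-identityʳ (ℤ.+ b))) (ℤ.+≤+ a≤b))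

fromℕ-nonNeg : ∀ m → 0ℚ ≤ fromℕ m
fromℕ-nonNeg m = ℚP.nonNegative⁻¹ (fromℕ m)

½^k*2^k : ∀ k → ½ ^ℚ k * fromℕ (2 ℕ.^ k) ≡ 1ℚ
½^k*2^k zero = refl
½^k*2^k (suc k) = begin
  (½ * ½ ^ℚ k) * fromℕ (2 ℕ.* 2 ℕ.^ k) ≡⟨ cong ((½ * ½ ^ℚ k) *_) (fromℕ-* 2 (2 ℕ.^ k)) ⟩
  (½ * ½ ^ℚ k) * (fromℕ 2 * fromℕ (2 ℕ.^ k)) ≡⟨ *.interchange ½ (½ ^ℚ k) (fromℕ 2) (fromℕ (2 ℕ.^ k)) ⟩
  (½ * fromℕ 2) * (½ ^ℚ k * fromℕ (2 ℕ.^ k)) ≡⟨ cong ((½ * fromℕ 2) *_) (½^k*2^k k) ⟩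
  1ℚ ∎
  where open ≡-Reasoning

*↧ₙ≡↥ : ∀ a {m} → ↥ a ≡ ℤ.+ m → a * fromℕ (↧ₙ a) ≡ fromℕ m
*↧ₙ≡↥ a@(mkℚ _ d-1 _) {m} refl = ℚP.toℚᵘ-injective (ℚᵘP.≃-trans (ℚP.toℚᵘ-homo-* a (fromℕ (suc d-1))) (ℚᵘ.*≡* eq))
  where
  eq : (ℤ.+ m ℤ.* ℤ.+ suc d-1) ℤ.* ℤ.+ 1 ≡ ℤ.+ m ℤ.* ℤ.+ (suc d-1 ℕ.* 1)
  eq = trans (ℤP.*-identityʳ _) (cong (λ e → ℤ.+ m ℤ.* ℤ.+ e) (sym (ℕP.*-identityʳ (suc d-1))))

∑-allPoints-suc : ∀ n (h : Cube (suc n) → ℚ) →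
  ∑ (allPoints (suc n)) h ≡ ∑ (allPoints n) (λ x → h (false ∷ x)) + ∑ (allPoints n) (λ x → h (true ∷ x))
∑-allPoints-suc n h = split-pairs (allPoints n)
  where
  split-pairs : (xs : List (Cube n)) →
    ∑ (concatMap (λ x → (false ∷ x) ∷ (true ∷ x) ∷ []) xs) h ≡ ∑ xs (λ x → h (false ∷ x)) + ∑ xs (λ x → h (true ∷ x))
  split-pairs []       = refl
  split-pairs (x ∷ xs) = begin
    h (false ∷ x) + (h (true ∷ x) + ∑ (concatMap _ xs) h)
      ≡⟨ cong (λ r → h (false ∷ x) + (h (true ∷ x) + r)) (split-pairs xs) ⟩
    h (false ∷ x) + (h (true ∷ x) + (∑ xs (λ x → h (false ∷ x)) + ∑ xs (λ x → h (true ∷ x))))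
      ≡⟨ ℚP.+-assoc (h (false ∷ x)) (h (true ∷ x)) _ ⟨
    h (false ∷ x) + h (true ∷ x) + (∑ xs (λ x → h (false ∷ x)) + ∑ xs (λ x → h (true ∷ x)))
      ≡⟨ +.interchange (h (false ∷ x)) (h (true ∷ x)) _ _ ⟩
    (h (false ∷ x) + ∑ xs (λ x → h (false ∷ x))) + (h (true ∷ x) + ∑ xs (λ x → h (true ∷ x))) ∎
    where open ≡-Reasoning

module _ (n : ℕ) where

  𝔼-cong : {g h : Cube n → ℚ} → (∀ x → g x ≡ h x) → 𝔼 n g ≡ 𝔼 n h
  𝔼-cong g≡h = ∑-cong (allPoints n) (λ x → cong (_* (½ ^ℚ n)) (g≡h x))

  𝔼-+ : (g h : Cube n → ℚ) → 𝔼 n (λ x → g x + h x) ≡ 𝔼 n g + 𝔼 n h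
  𝔼-+ g h = trans (∑-cong (allPoints n) (λ x → ℚP.*-distribʳ-+ (½ ^ℚ n) (g x) (h x))) (∑-+ (allPoints n) _ _)

  𝔼-*ˡ : (c : ℚ) (g : Cube n → ℚ) → 𝔼 n (λ x → c * g x) ≡ c * 𝔼 n g
  𝔼-*ˡ c g = trans (∑-cong (allPoints n) (λ x → ℚP.*-assoc c (g x) _)) (∑-*ˡ (allPoints n) c _)

  𝔼-*ʳ : (g : Cube n → ℚ) (c : ℚ) → 𝔼 n (λ x → g x * c) ≡ 𝔼 n g * c
  𝔼-*ʳ g c = begin
    𝔼 n (λ x → g x * c) ≡⟨ 𝔼-cong (λ x → ℚP.*-comm (g x) c) ⟩
    𝔼 n (λ x → c * g x) ≡⟨ 𝔼-*ˡ c g ⟩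
    c * 𝔼 n g           ≡⟨ ℚP.*-comm c (𝔼 n g) ⟩
    𝔼 n g * c           ∎
    where open ≡-Reasoning

𝔼-split : ∀ n (g : Cube (suc n) → ℚ) →
  𝔼 (suc n) g ≡ ½ * (𝔼 n (λ x → g (false ∷ x)) + 𝔼 n (λ x → g (true ∷ x)))
𝔼-split n g = begin
  𝔼 (suc n) g
    ≡⟨ ∑-allPoints-suc n _ ⟩
  ∑ (allPoints n) (λ x → g (false ∷ x) * (½ * ½ ^ℚ n)) + ∑ (allPoints n) (λ x → g (true ∷ x) * (½ * ½ ^ℚ n))
    ≡⟨ cong₂ _+_ (half (λ x → g (false ∷ x))) (half (λ x → g (true ∷ x))) ⟩
  ½ * 𝔼 n (λ x → g (false ∷ x)) + ½ * 𝔼 n (λ x → g (true ∷ x))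
    ≡⟨ ℚP.*-distribˡ-+ ½ (𝔼 n (λ x → g (false ∷ x))) (𝔼 n (λ x → g (true ∷ x))) ⟨
  ½ * (𝔼 n (λ x → g (false ∷ x)) + 𝔼 n (λ x → g (true ∷ x))) ∎
  where
  open ≡-Reasoning
  half : (h : Cube n → ℚ) → ∑ (allPoints n) (λ x → h x * (½ * ½ ^ℚ n)) ≡ ½ * 𝔼 n h
  half h = trans (∑-cong (allPoints n) (λ x → *.x∙yz≈y∙xz (h x) ½ (½ ^ℚ n)))
                 (∑-*ˡ (allPoints n) ½ _)

½*[x+x]≡x : ∀ x → ½ * (x + x) ≡ x
½*[x+x]≡x = solve 1 (λ x → con ½ :* (x :+ x) := x) refl

𝔼-const : ∀ n (c : ℚ) → 𝔼 n (λ _ → c) ≡ c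
𝔼-const zero    c = trans (ℚP.+-identityʳ _) (ℚP.*-identityʳ c)
𝔼-const (suc n) c = begin
  𝔼 (suc n) (λ _ → c) ≡⟨ 𝔼-split n (λ _ → c) ⟩
  ½ * (𝔼 n (λ _ → c) + 𝔼 n (λ _ → c)) ≡⟨ cong (λ e → ½ * (e + e)) (𝔼-const n c) ⟩
  ½ * (c + c)           ≡⟨ ½*[x+x]≡x c ⟩
  c                     ∎
  where open ≡-Reasoning

𝔼-mono-≤ : ∀ n {g h : Cube n → ℚ} → (∀ x → g x ≤ h x) → 𝔼 n g ≤ 𝔼 n h
𝔼-mono-≤ zero    g≤h = ℚP.+-monoˡ-≤ 0ℚ (ℚP.*-monoʳ-≤-nonNeg 1ℚ (g≤h []))
𝔼-mono-≤ (suc n) {g} {h} g≤h = begin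
  𝔼 (suc n) g ≡⟨ 𝔼-split n g ⟩
  ½ * (𝔼 n (λ x → g (false ∷ x)) + 𝔼 n (λ x → g (true ∷ x)))
    ≤⟨ ℚP.*-monoˡ-≤-nonNeg ½ (ℚP.+-mono-≤ (𝔼-mono-≤ n (λ x → g≤h (false ∷ x))) (𝔼-mono-≤ n (λ x → g≤h (true ∷ x)))) ⟩
  ½ * (𝔼 n (λ x → h (false ∷ x)) + 𝔼 n (λ x → h (true ∷ x))) ≡⟨ 𝔼-split n h ⟨
  𝔼 (suc n) h ∎
  where open ℚP.≤-Reasoning

𝔼-∑ : ∀ n {A : Set} (xs : List A) (h : Cube n → A → ℚ) →
  𝔼 n (λ x → ∑ xs (h x)) ≡ ∑ xs (λ a → 𝔼 n (λ x → h x a))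
𝔼-∑ n []       h = 𝔼-const n 0ℚ
𝔼-∑ n (a ∷ xs) h = trans (𝔼-+ n (λ x → h x a) (λ x → ∑ xs (h x))) (cong (𝔼 n (λ x → h x a) +_) (𝔼-∑ n xs h))

𝔼-split² : ∀ n (G : Cube (suc n) → Cube (suc n) → ℚ) →
  let A = λ b c → 𝔼 n (λ x → 𝔼 n (λ z → G (b ∷ x) (c ∷ z))) in
  𝔼 (suc n) (λ x → 𝔼 (suc n) (G x)) ≡ ½ * (½ * (A false false + A false true) + ½ * (A true false + A true true))
𝔼-split² n G = begin
  𝔼 (suc n) (λ x → 𝔼 (suc n) (G x))
    ≡⟨ 𝔼-split n (λ x → 𝔼 (suc n) (G x)) ⟩
  ½ * (𝔼 n (λ x → 𝔼 (suc n) (G (false ∷ x))) + 𝔼 n (λ x → 𝔼 (suc n) (G (true ∷ x))))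
    ≡⟨ cong₂ (λ a b → ½ * (a + b)) (inner false) (inner true) ⟩
  ½ * (½ * (A false false + A false true) + ½ * (A true false + A true true)) ∎
  where
  open ≡-Reasoning
  A : Bool → Bool → ℚ
  A b c = 𝔼 n (λ x → 𝔼 n (λ z → G (b ∷ x) (c ∷ z)))
  inner : ∀ b → 𝔼 n (λ x → 𝔼 (suc n) (G (b ∷ x))) ≡ ½ * (A b false + A b true)
  inner b = begin
    𝔼 n (λ x → 𝔼 (suc n) (G (b ∷ x)))      ≡⟨ 𝔼-cong n (λ x → 𝔼-split n (G (b ∷ x))) ⟩
    𝔼 n (λ x → ½ * (F x false + F x true))  ≡⟨ 𝔼-*ˡ n ½ (λ x → F x false + F x true) ⟩
    ½ * 𝔼 n (λ x → F x false + F x true)    ≡⟨ cong (½ *_) (𝔼-+ n (λ x → F x false) (λ x → F x true)) ⟩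
    ½ * (A b false + A b true)              ∎
    where
    F : Cube n → Bool → ℚ
    F x c = 𝔼 n (λ z → G (b ∷ x) (c ∷ z))

𝔼-rerandomise : ∀ n (R : Vec Bool n) (g : Cube n → ℚ) →
  𝔼 n (λ x → 𝔼 n (λ z → g (rerandomise R x z))) ≡ 𝔼 n g
𝔼-rerandomise zero    []      g = 𝔼-const 0 (𝔼 0 g)
𝔼-rerandomise (suc n) (r ∷ R) g = begin
  𝔼 (suc n) (λ x → 𝔼 (suc n) (λ z → g (rerandomise (r ∷ R) x z)))
    ≡⟨ 𝔼-split² n (λ x z → g (rerandomise (r ∷ R) x z)) ⟩
  ½ * (½ * (A false false + A false true) + ½ * (A true false + A true true))
    ≡⟨ cong₂ (λ a b → ½ * (a + b)) (cong₂ (λ a b → ½ * (a + b)) (IH false false) (IH false true))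
                                   (cong₂ (λ a b → ½ * (a + b)) (IH true false) (IH true true)) ⟩
  ½ * (½ * (Q (pick r false false) + Q (pick r false true)) + ½ * (Q (pick r true false) + Q (pick r true true)))
    ≡⟨ average-pick r ⟩
  ½ * (Q false + Q true)
    ≡⟨ 𝔼-split n g ⟨
  𝔼 (suc n) g ∎
  where
  open ≡-Reasoning
  pick : Bool → Bool → Bool → Bool
  pick r b c = if r then c else b
  A : Bool → Bool → ℚ
  A b c = 𝔼 n (λ x → 𝔼 n (λ z → g (pick r b c ∷ rerandomise R x z)))
  Q : Bool → ℚ
  Q e = 𝔼 n (λ y → g (e ∷ y))
  IH : ∀ b c → A b c ≡ Q (pick r b c)
  IH b c = 𝔼-rerandomise n R (λ y → g (pick r b c ∷ y))
  average-pick : ∀ r →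
    ½ * (½ * (Q (pick r false false) + Q (pick r false true)) + ½ * (Q (pick r true false) + Q (pick r true true)))
      ≡ ½ * (Q false + Q true)
  average-pick true  = ½*[x+x]≡x (½ * (Q false + Q true))
  average-pick false = cong₂ (λ a b → ½ * (a + b)) (½*[x+x]≡x (Q false)) (½*[x+x]≡x (Q true))

nonNeg-* : ∀ {a b} → 0ℚ ≤ a → 0ℚ ≤ b → 0ℚ ≤ a * b
nonNeg-* {a} {b} 0≤a 0≤b =
  ℚP.nonNegative⁻¹ (a * b) {{ℚP.nonNeg*nonNeg⇒nonNeg a {{ℚ.nonNegative 0≤a}} b {{ℚ.nonNegative 0≤b}}}}

patternWeight-nonNeg : ∀ {n p} → 0ℚ ≤ p → p ≤ 1ℚ → (R : Vec Bool n) → 0ℚ ≤ patternWeight p R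
patternWeight-nonNeg         0≤p p≤1 []          = ℚP.nonNegative⁻¹ 1ℚ
patternWeight-nonNeg         0≤p p≤1 (true  ∷ R) = nonNeg-* 0≤p (patternWeight-nonNeg 0≤p p≤1 R)
patternWeight-nonNeg {p = p} 0≤p p≤1 (false ∷ R) = nonNeg-* 0≤1-p (patternWeight-nonNeg 0≤p p≤1 R)
  where
  0≤1-p : 0ℚ ≤ 1ℚ - p
  0≤1-p = subst (_≤ 1ℚ - p) (ℚP.+-inverseʳ p) (ℚP.+-monoˡ-≤ (ℚ.- p) p≤1)

1-p+p≡1 : ∀ p → 1ℚ - p + p ≡ 1ℚ
1-p+p≡1 p = begin
  1ℚ - p + p       ≡⟨ ℚP.+-assoc 1ℚ (ℚ.- p) p ⟩
  1ℚ + (ℚ.- p + p) ≡⟨ cong (1ℚ +_) (ℚP.+-inverseˡ p) ⟩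
  1ℚ + 0ℚ          ≡⟨⟩
  1ℚ               ∎
  where open ≡-Reasoning

∑-patternWeight : ∀ n p → ∑ (allPoints n) (patternWeight p) ≡ 1ℚ
∑-patternWeight zero    p = refl
∑-patternWeight (suc n) p = begin
  ∑ (allPoints (suc n)) (patternWeight p)
    ≡⟨ ∑-allPoints-suc n (patternWeight p) ⟩
  ∑ (allPoints n) (λ R → (1ℚ - p) * patternWeight p R) + ∑ (allPoints n) (λ R → p * patternWeight p R)
    ≡⟨ cong₂ _+_ (∑-*ˡ (allPoints n) (1ℚ - p) (patternWeight p)) (∑-*ˡ (allPoints n) p (patternWeight p)) ⟩
  (1ℚ - p) * W + p * W ≡⟨ ℚP.*-distribʳ-+ W (1ℚ - p) p ⟨
  (1ℚ - p + p) * W      ≡⟨ cong₂ _*_ (1-p+p≡1 p) (∑-patternWeight n p) ⟩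
  1ℚ * 1ℚ               ≡⟨⟩
  1ℚ ∎
  where
  open ≡-Reasoning
  W = ∑ (allPoints n) (patternWeight p)

-- x and z are uniform and R has independent p-biased entries, so y = rerandomise R x z
-- is a p-noisy copy of x.
𝔼noise : ∀ n → ℚ → (Cube n → Vec Bool n → Cube n → ℚ) → ℚ
𝔼noise n p h = 𝔼 n (λ x → ∑ (allPoints n) (λ R → patternWeight p R * 𝔼 n (h x R)))

module _ {n : ℕ} {p : ℚ} where

  private
    ∑ᴿ : (Vec Bool n → ℚ) → ℚ
    ∑ᴿ = ∑ (allPoints n)

  𝔼noise-mono-≤ : 0ℚ ≤ p → p ≤ 1ℚ → {g h : Cube n → Vec Bool n → Cube n → ℚ} →
    (∀ x R z → g x R z ≤ h x R z) → 𝔼noise n p g ≤ 𝔼noise n p h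
  𝔼noise-mono-≤ 0≤p p≤1 g≤h = 𝔼-mono-≤ n λ x → ∑-mono-≤ (allPoints n) λ R →
    ℚP.*-monoˡ-≤-nonNeg (patternWeight p R) {{ℚ.nonNegative (patternWeight-nonNeg 0≤p p≤1 R)}}
      (𝔼-mono-≤ n (g≤h x R))

  𝔼noise-+ : (g h : Cube n → Vec Bool n → Cube n → ℚ) →
    𝔼noise n p (λ x R z → g x R z + h x R z) ≡ 𝔼noise n p g + 𝔼noise n p h
  𝔼noise-+ g h = begin
    𝔼 n (λ x → ∑ᴿ (λ R → w R * 𝔼 n (λ z → g x R z + h x R z)))
      ≡⟨ 𝔼-cong n (λ x → ∑-cong (allPoints n) (λ R → trans (cong (w R *_) (𝔼-+ n (g x R) (h x R)))
                                                         (ℚP.*-distribˡ-+ (w R) _ _))) ⟩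
    𝔼 n (λ x → ∑ᴿ (λ R → w R * 𝔼 n (g x R) + w R * 𝔼 n (h x R)))
      ≡⟨ 𝔼-cong n (λ x → ∑-+ (allPoints n) (λ R → w R * 𝔼 n (g x R)) (λ R → w R * 𝔼 n (h x R))) ⟩
    𝔼 n (λ x → ∑ᴿ (λ R → w R * 𝔼 n (g x R)) + ∑ᴿ (λ R → w R * 𝔼 n (h x R)))
      ≡⟨ 𝔼-+ n (λ x → ∑ᴿ (λ R → w R * 𝔼 n (g x R))) (λ x → ∑ᴿ (λ R → w R * 𝔼 n (h x R))) ⟩
    𝔼noise n p g + 𝔼noise n p h ∎
    where
    open ≡-Reasoning
    w = patternWeight p

  𝔼noise-product : (g : Cube n → ℚ) (h : Vec Bool n → ℚ) →
    𝔼noise n p (λ x R _ → g x * h R) ≡ 𝔼 n g * ∑ᴿ (λ R → patternWeight p R * h R)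
  𝔼noise-product g h = begin
    𝔼 n (λ x → ∑ᴿ (λ R → w R * 𝔼 n (λ _ → g x * h R)))
      ≡⟨ 𝔼-cong n (λ x → ∑-cong (allPoints n) (λ R →
           trans (cong (w R *_) (𝔼-const n (g x * h R)))
                 (*.x∙yz≈y∙xz (w R) (g x) (h R)))) ⟩
    𝔼 n (λ x → ∑ᴿ (λ R → g x * (w R * h R)))
      ≡⟨ 𝔼-cong n (λ x → ∑-*ˡ (allPoints n) (g x) (λ R → w R * h R)) ⟩
    𝔼 n (λ x → g x * ∑ᴿ (λ R → w R * h R))
      ≡⟨ 𝔼-*ʳ n g _ ⟩
    𝔼 n g * ∑ᴿ (λ R → w R * h R) ∎
    where
    open ≡-Reasoning
    w = patternWeight p

  𝔼noise-fst : (g : Cube n → ℚ) → 𝔼noise n p (λ x _ _ → g x) ≡ 𝔼 n g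
  𝔼noise-fst g = begin
    𝔼noise n p (λ x _ _ → g x)
      ≡⟨ 𝔼-cong n (λ x → ∑-cong (allPoints n) (λ R → cong (patternWeight p R *_)
           (𝔼-cong n (λ _ → sym (ℚP.*-identityʳ (g x)))))) ⟩
    𝔼noise n p (λ x _ _ → g x * 1ℚ)
      ≡⟨ 𝔼noise-product g (λ _ → 1ℚ) ⟩
    𝔼 n g * ∑ᴿ (λ R → patternWeight p R * 1ℚ)
      ≡⟨ cong (𝔼 n g *_) (trans (∑-cong (allPoints n) (λ R → ℚP.*-identityʳ (patternWeight p R)))
                                 (∑-patternWeight n p)) ⟩
    𝔼 n g * 1ℚ ≡⟨ ℚP.*-identityʳ (𝔼 n g) ⟩
    𝔼 n g ∎
    where open ≡-Reasoning

  𝔼noise-snd : (g : Cube n → ℚ) → 𝔼noise n p (λ x R z → g (rerandomise R x z)) ≡ 𝔼 n g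
  𝔼noise-snd g = begin
    𝔼 n (λ x → ∑ᴿ (λ R → w R * 𝔼 n (λ z → g (rerandomise R x z))))
      ≡⟨ 𝔼-∑ n (allPoints n) (λ x R → w R * 𝔼 n (λ z → g (rerandomise R x z))) ⟩
    ∑ᴿ (λ R → 𝔼 n (λ x → w R * 𝔼 n (λ z → g (rerandomise R x z))))
      ≡⟨ ∑-cong (allPoints n) (λ R → trans (𝔼-*ˡ n (w R) _) (cong (w R *_) (𝔼-rerandomise n R g))) ⟩
    ∑ᴿ (λ R → w R * 𝔼 n g)
      ≡⟨ ∑-*ʳ (allPoints n) w (𝔼 n g) ⟩
    ∑ᴿ w * 𝔼 n g ≡⟨ cong (_* 𝔼 n g) (∑-patternWeight n p) ⟩
    1ℚ * 𝔼 n g ≡⟨ ℚP.*-identityˡ (𝔼 n g) ⟩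
    𝔼 n g ∎
    where
    open ≡-Reasoning
    w = patternWeight p

  𝔼noise-∑ : {A : Set} (xs : List A) (h : A → Cube n → Vec Bool n → Cube n → ℚ) →
    𝔼noise n p (λ x R z → ∑ xs (λ a → h a x R z)) ≡ ∑ xs (λ a → 𝔼noise n p (h a))
  𝔼noise-∑ []       h = trans (𝔼noise-fst (λ _ → 0ℚ)) (𝔼-const n 0ℚ)
  𝔼noise-∑ (a ∷ xs) h = trans (𝔼noise-+ (h a) (λ x R z → ∑ xs (λ a → h a x R z)))
                              (cong (𝔼noise n p (h a) +_) (𝔼noise-∑ xs h))

𝟙-nonNeg : ∀ b → 0ℚ ≤ 𝟙 b
𝟙-nonNeg true  = ℚP.nonNegative⁻¹ 1ℚ
𝟙-nonNeg false = ℚP.≤-refl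

𝟙≤1 : ∀ b → 𝟙 b ≤ 1ℚ
𝟙≤1 true  = ℚP.≤-refl
𝟙≤1 false = ℚP.nonNegative⁻¹ 1ℚ

𝟙-xor-triangle : ∀ a b c → 𝟙 (a xor c) ≤ 𝟙 (a xor b) + 𝟙 (b xor c)
𝟙-xor-triangle true  true  c = ℚP.≤-reflexive (sym (ℚP.+-identityˡ _))
𝟙-xor-triangle false false c = ℚP.≤-reflexive (sym (ℚP.+-identityˡ _))
𝟙-xor-triangle true  false c = ℚP.≤-trans (𝟙≤1 _) (ℚP.+-monoʳ-≤ 1ℚ (𝟙-nonNeg (false xor c)))
𝟙-xor-triangle false true  c = ℚP.≤-trans (𝟙≤1 _) (ℚP.+-monoʳ-≤ 1ℚ (𝟙-nonNeg (true xor c)))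

NS-triangle : ∀ {n} {p} → 0ℚ ≤ p → p ≤ 1ℚ → (f g : Cube n → Bool) →
  NS p f ≤ dist f g + (NS p g + dist f g)
NS-triangle {n} {p} 0≤p p≤1 f g = begin
  NS p f
    ≤⟨ 𝔼noise-mono-≤ 0≤p p≤1 (λ x R z → detour (f x) (g x) (g (rerandomise R x z)) (f (rerandomise R x z))) ⟩
  𝔼noise n p (λ x R z → D x + (𝟙 (g x xor g (rerandomise R x z)) + D (rerandomise R x z)))
    ≡⟨ 𝔼noise-+ (λ x _ _ → D x) (λ x R z → 𝟙 (g x xor g (rerandomise R x z)) + D (rerandomise R x z)) ⟩
  𝔼noise n p (λ x _ _ → D x) + 𝔼noise n p (λ x R z → 𝟙 (g x xor g (rerandomise R x z)) + D (rerandomise R x z))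
    ≡⟨ cong₂ _+_ (𝔼noise-fst D) (𝔼noise-+ (λ x R z → 𝟙 (g x xor g (rerandomise R x z))) (λ x R z → D (rerandomise R x z))) ⟩
  dist f g + (NS p g + 𝔼noise n p (λ x R z → D (rerandomise R x z)))
    ≡⟨ cong (λ e → dist f g + (NS p g + e)) (𝔼noise-snd D) ⟩
  dist f g + (NS p g + dist f g) ∎
  where
  open ℚP.≤-Reasoning
  D : Cube n → ℚ
  D x = 𝟙 (f x xor g x)
  detour : ∀ a b c d → 𝟙 (a xor d) ≤ 𝟙 (a xor b) + (𝟙 (b xor c) + 𝟙 (d xor c))
  detour a b c d = ℚP.≤-trans (𝟙-xor-triangle a b d)
    (ℚP.+-monoʳ-≤ (𝟙 (a xor b)) (subst (λ e → 𝟙 (b xor d) ≤ 𝟙 (b xor c) + 𝟙 e) (xor-comm c d) (𝟙-xor-triangle b c d)))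

Subcube : ℕ → Set
Subcube n = Vec (Maybe Bool) n

wholeCube : ∀ n → Subcube n
wholeCube n = replicate n nothing

contains : ∀ {n} → Subcube n → Cube n → Bool
contains []                []          = true
contains (nothing    ∷ C)  (_     ∷ x) = contains C x
contains (just true  ∷ C)  (true  ∷ x) = contains C x
contains (just false ∷ C)  (false ∷ x) = contains C x
contains (just _     ∷ _)  (_     ∷ _) = false

codim : ∀ {n} → Subcube n → ℕ
codim []            = 0
codim (nothing ∷ C) = codim C
codim (just _  ∷ C) = suc (codim C)

dim : ∀ {n} → Subcube n → ℕ
dim []            = 0
dim (nothing ∷ C) = suc (dim C)
dim (just _  ∷ C) = dim C

hits : ∀ {n} → Vec Bool n → Subcube n → ℕ
hits []          []           = 0
hits (true  ∷ R) (just _ ∷ C) = suc (hits R C)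
hits (true  ∷ R) (nothing ∷ C) = hits R C
hits (false ∷ R) (_ ∷ C)      = hits R C

codim+dim≡n : ∀ {n} (C : Subcube n) → codim C ℕ.+ dim C ≡ n
codim+dim≡n []            = refl
codim+dim≡n (nothing ∷ C) = trans (ℕP.+-suc (codim C) (dim C)) (cong suc (codim+dim≡n C))
codim+dim≡n (just _  ∷ C) = cong suc (codim+dim≡n C)

codim-wholeCube : ∀ n → codim (wholeCube n) ≡ 0
codim-wholeCube zero    = refl
codim-wholeCube (suc n) = codim-wholeCube n

dim-wholeCube : ∀ n → dim (wholeCube n) ≡ n
dim-wholeCube zero    = refl
dim-wholeCube (suc n) = cong suc (dim-wholeCube n)

contains-wholeCube : ∀ {n} (x : Cube n) → contains (wholeCube n) x ≡ true
contains-wholeCube []      = refl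
contains-wholeCube (_ ∷ x) = contains-wholeCube x

codim-fix : ∀ {n} (C : Subcube n) i b → lookup C i ≡ nothing → codim (C [ i ]≔ just b) ≡ suc (codim C)
codim-fix (nothing ∷ C) zero    b _     = refl
codim-fix (nothing ∷ C) (suc i) b Cᵢ≡∗ = codim-fix C i b Cᵢ≡∗
codim-fix (just _  ∷ C) (suc i) b Cᵢ≡∗ = cong suc (codim-fix C i b Cᵢ≡∗)

dim-fix : ∀ {n} (C : Subcube n) i b → lookup C i ≡ nothing → dim C ≡ suc (dim (C [ i ]≔ just b))
dim-fix (nothing ∷ C) zero    b _     = refl
dim-fix (nothing ∷ C) (suc i) b Cᵢ≡∗ = cong suc (dim-fix C i b Cᵢ≡∗)
dim-fix (just _  ∷ C) (suc i) b Cᵢ≡∗ = dim-fix C i b Cᵢ≡∗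

contains-lookup : ∀ {n} (C : Subcube n) x i {c} → contains C x ≡ true → lookup C i ≡ just c → lookup x i ≡ c
contains-lookup (just true  ∷ C) (true  ∷ x) zero    _   refl = refl
contains-lookup (just false ∷ C) (false ∷ x) zero    _   refl = refl
contains-lookup (nothing    ∷ C) (_     ∷ x) (suc i) x∈C Cᵢ≡c = contains-lookup C x i x∈C Cᵢ≡c
contains-lookup (just true  ∷ C) (true  ∷ x) (suc i) x∈C Cᵢ≡c = contains-lookup C x i x∈C Cᵢ≡c
contains-lookup (just false ∷ C) (false ∷ x) (suc i) x∈C Cᵢ≡c = contains-lookup C x i x∈C Cᵢ≡c

contains-fix⁻ : ∀ {n} (C : Subcube n) x i {c} → lookup C i ≡ nothing →
  contains (C [ i ]≔ just c) x ≡ true → contains C x ≡ true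
contains-fix⁻ (nothing ∷ C)    (true  ∷ x) zero    {true}  _ x∈C = x∈C
contains-fix⁻ (nothing ∷ C)    (false ∷ x) zero    {false} _ x∈C = x∈C
contains-fix⁻ (nothing ∷ C)    (_ ∷ x)     (suc i)         Cᵢ≡∗ x∈C = contains-fix⁻ C x i Cᵢ≡∗ x∈C
contains-fix⁻ (just true  ∷ C) (true  ∷ x) (suc i)         Cᵢ≡∗ x∈C = contains-fix⁻ C x i Cᵢ≡∗ x∈C
contains-fix⁻ (just false ∷ C) (false ∷ x) (suc i)         Cᵢ≡∗ x∈C = contains-fix⁻ C x i Cᵢ≡∗ x∈C

contains-fix⁺ : ∀ {n} (C : Subcube n) x i {b} → lookup C i ≡ nothing → lookup x i ≡ b →
  contains C x ≡ true → contains (C [ i ]≔ just b) x ≡ true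
contains-fix⁺ (nothing ∷ C)    (true  ∷ x) zero    _    refl x∈C = x∈C
contains-fix⁺ (nothing ∷ C)    (false ∷ x) zero    _    refl x∈C = x∈C
contains-fix⁺ (nothing ∷ C)    (_ ∷ x)     (suc i) Cᵢ≡∗ xᵢ≡b x∈C = contains-fix⁺ C x i Cᵢ≡∗ xᵢ≡b x∈C
contains-fix⁺ (just true  ∷ C) (true  ∷ x) (suc i) Cᵢ≡∗ xᵢ≡b x∈C = contains-fix⁺ C x i Cᵢ≡∗ xᵢ≡b x∈C
contains-fix⁺ (just false ∷ C) (false ∷ x) (suc i) Cᵢ≡∗ xᵢ≡b x∈C = contains-fix⁺ C x i Cᵢ≡∗ xᵢ≡b x∈C

contains-rerandomise : ∀ {n} (R : Vec Bool n) (C : Subcube n) x z → hits R C ≡ 0 →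
  contains C x ≡ true → contains C (rerandomise R x z) ≡ true
contains-rerandomise []          []               []          []      _  _   = refl
contains-rerandomise (true  ∷ R) (nothing    ∷ C) (_     ∷ x) (_ ∷ z) hits≡0 x∈C = contains-rerandomise R C x z hits≡0 x∈C
contains-rerandomise (false ∷ R) (nothing    ∷ C) (_     ∷ x) (_ ∷ z) hits≡0 x∈C = contains-rerandomise R C x z hits≡0 x∈C
contains-rerandomise (false ∷ R) (just true  ∷ C) (true  ∷ x) (_ ∷ z) hits≡0 x∈C = contains-rerandomise R C x z hits≡0 x∈C
contains-rerandomise (false ∷ R) (just false ∷ C) (false ∷ x) (_ ∷ z) hits≡0 x∈C = contains-rerandomise R C x z hits≡0 x∈C


𝔼-contains : ∀ {n} (C : Subcube n) → 𝔼 n (λ x → 𝟙 (contains C x)) ≡ ½ ^ℚ codim C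
𝔼-contains []            = refl
𝔼-contains {suc n} (nothing ∷ C) = begin
  𝔼 (suc n) (λ x → 𝟙 (contains (nothing ∷ C) x))                  ≡⟨ 𝔼-split n (λ x → 𝟙 (contains (nothing ∷ C) x)) ⟩
  ½ * (𝔼 n (λ x → 𝟙 (contains C x)) + 𝔼 n (λ x → 𝟙 (contains C x))) ≡⟨ ½*[x+x]≡x (𝔼 n (λ x → 𝟙 (contains C x))) ⟩
  𝔼 n (λ x → 𝟙 (contains C x))                                    ≡⟨ 𝔼-contains C ⟩
  ½ ^ℚ codim C                                                    ∎
  where open ≡-Reasoning
𝔼-contains {suc n} (just true ∷ C) = begin
  𝔼 (suc n) (λ x → 𝟙 (contains (just true ∷ C) x))   ≡⟨ 𝔼-split n (λ x → 𝟙 (contains (just true ∷ C) x)) ⟩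
  ½ * (𝔼 n (λ _ → 0ℚ) + 𝔼 n (λ x → 𝟙 (contains C x))) ≡⟨ cong₂ (λ a b → ½ * (a + b)) (𝔼-const n 0ℚ) (𝔼-contains C) ⟩
  ½ * (0ℚ + ½ ^ℚ codim C)                             ≡⟨ cong (½ *_) (ℚP.+-identityˡ (½ ^ℚ codim C)) ⟩
  ½ ^ℚ codim (just true ∷ C)                          ∎
  where open ≡-Reasoning
𝔼-contains {suc n} (just false ∷ C) = begin
  𝔼 (suc n) (λ x → 𝟙 (contains (just false ∷ C) x))  ≡⟨ 𝔼-split n (λ x → 𝟙 (contains (just false ∷ C) x)) ⟩
  ½ * (𝔼 n (λ x → 𝟙 (contains C x)) + 𝔼 n (λ _ → 0ℚ)) ≡⟨ cong₂ (λ a b → ½ * (a + b)) (𝔼-contains C) (𝔼-const n 0ℚ) ⟩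
  ½ * (½ ^ℚ codim C + 0ℚ)                             ≡⟨ cong (½ *_) (ℚP.+-identityʳ (½ ^ℚ codim C)) ⟩
  ½ ^ℚ codim (just false ∷ C)                         ∎
  where open ≡-Reasoning

∑-hits : ∀ {n} p (C : Subcube n) →
  ∑ (allPoints n) (λ R → patternWeight p R * fromℕ (hits R C)) ≡ p * fromℕ (codim C)
∑-hits p []            = sym (ℚP.*-zeroʳ p)
∑-hits {suc n} p (c ∷ C) = begin
  ∑ (allPoints (suc n)) (λ R → patternWeight p R * fromℕ (hits R (c ∷ C)))
    ≡⟨ ∑-allPoints-suc n _ ⟩
  ∑ A (λ R → ((1ℚ - p) * w R) * h R) + ∑ A (λ R → (p * w R) * fromℕ (hits (true ∷ R) (c ∷ C)))
    ≡⟨ cong₂ _+_ (scale (1ℚ - p) h) (scale p (λ R → fromℕ (hits (true ∷ R) (c ∷ C)))) ⟩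
  (1ℚ - p) * S + p * ∑ A (λ R → w R * fromℕ (hits (true ∷ R) (c ∷ C)))
    ≡⟨ hit c ⟩
  p * fromℕ (codim (c ∷ C)) ∎
  where
  open ≡-Reasoning
  A = allPoints n
  w = patternWeight p
  h : Vec Bool n → ℚ
  h R = fromℕ (hits R C)
  S = ∑ A (λ R → w R * h R)
  scale : ∀ a (g : Vec Bool n → ℚ) → ∑ A (λ R → (a * w R) * g R) ≡ a * ∑ A (λ R → w R * g R)
  scale a g = trans (∑-cong A (λ R → ℚP.*-assoc a (w R) (g R))) (∑-*ˡ A a (λ R → w R * g R))
  hit : ∀ c → (1ℚ - p) * S + p * ∑ A (λ R → w R * fromℕ (hits (true ∷ R) (c ∷ C))) ≡ p * fromℕ (codim (c ∷ C))
  hit nothing = begin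
    (1ℚ - p) * S + p * S ≡⟨ ℚP.*-distribʳ-+ S (1ℚ - p) p ⟨
    (1ℚ - p + p) * S     ≡⟨ cong (_* S) (1-p+p≡1 p) ⟩
    1ℚ * S               ≡⟨ ℚP.*-identityˡ S ⟩
    S                    ≡⟨ ∑-hits p C ⟩
    p * fromℕ (codim C)  ∎
  hit (just _) = begin
    (1ℚ - p) * S + p * ∑ A (λ R → w R * fromℕ (1 ℕ.+ hits R C))
      ≡⟨ cong (λ e → (1ℚ - p) * S + p * e) (∑-cong A (λ R → cong (w R *_) (fromℕ-+ 1 (hits R C)))) ⟩
    (1ℚ - p) * S + p * ∑ A (λ R → w R * (1ℚ + h R))
      ≡⟨ cong (λ e → (1ℚ - p) * S + p * e) (∑-cong A (λ R → trans (ℚP.*-distribˡ-+ (w R) 1ℚ (h R))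
                                                                  (cong (_+ w R * h R) (ℚP.*-identityʳ (w R))))) ⟩
    (1ℚ - p) * S + p * ∑ A (λ R → w R + w R * h R)
      ≡⟨ cong (λ e → (1ℚ - p) * S + p * e) (trans (∑-+ A w (λ R → w R * h R)) (cong (_+ S) (∑-patternWeight n p))) ⟩
    (1ℚ - p) * S + p * (1ℚ + S)
      ≡⟨ cong (λ e → (1ℚ - p) * e + p * (1ℚ + e)) (∑-hits p C) ⟩
    (1ℚ - p) * (p * k) + p * (1ℚ + p * k)
      ≡⟨ solve 2 (λ p k → (con 1ℚ :- p) :* (p :* k) :+ p :* (con 1ℚ :+ p :* k) := p :* (con 1ℚ :+ k)) refl p k ⟩
    p * (1ℚ + k)
      ≡⟨ cong (p *_) (fromℕ-+ 1 (codim C)) ⟨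
    p * fromℕ (suc (codim C)) ∎
    where k = fromℕ (codim C)

Leaf : ℕ → Set
Leaf n = Subcube n × Bool

-- A query of a coordinate already fixed by C is followed rather than branched on, so each leaf's
-- subcube fixes exactly the distinct coordinates queried on its path.
leaves : ∀ {n} → DTree n → Subcube n → List (Leaf n)
leaves (leaf b)       C = (C , b) ∷ []
leaves (node i t₀ t₁) C with lookup C i
... | just false = leaves t₀ C
... | just true  = leaves t₁ C
... | nothing    = leaves t₀ (C [ i ]≔ just false) ++ leaves t₁ (C [ i ]≔ just true)

evalDT-node : ∀ {n} (i : Fin n) t₀ t₁ x {b} → lookup x i ≡ b →
  evalDT (node i t₀ t₁) x ≡ evalDT (if b then t₁ else t₀) x
evalDT-node i t₀ t₁ x refl with lookup x i
... | true  = refl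
... | false = refl

LeafOf : ∀ {n} → DTree n → Subcube n → Leaf n → Set
LeafOf T C ℓ = ∀ y → contains (proj₁ ℓ) y ≡ true → contains C y ≡ true × evalDT T y ≡ proj₂ ℓ

LeafOf-node : ∀ {n} (i : Fin n) t₀ t₁ (C C′ : Subcube n) b →
  (∀ y → contains C′ y ≡ true → contains C y ≡ true × lookup y i ≡ b) →
  ∀ {ℓs} → All (LeafOf (if b then t₁ else t₀) C′) ℓs → All (LeafOf (node i t₀ t₁) C) ℓs
LeafOf-node i t₀ t₁ C C′ b C′⊆C = All.map (λ {ℓ} → refine {ℓ})
  where
  refine : ∀ {ℓ} → LeafOf (if b then t₁ else t₀) C′ ℓ → LeafOf (node i t₀ t₁) C ℓ
  refine ℓ-leaf y y∈D =
    let y∈C′ , t≡ = ℓ-leaf y y∈D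
        y∈C , yᵢ≡b = C′⊆C y y∈C′
    in y∈C , trans (evalDT-node i t₀ t₁ y yᵢ≡b) t≡

leaves-sound : ∀ {n} (T : DTree n) C → All (LeafOf T C) (leaves T C)
leaves-sound (leaf b)       C = (λ y y∈C → y∈C , refl) ∷ []
leaves-sound (node i t₀ t₁) C with lookup C i in Cᵢ≡
... | just false = LeafOf-node i t₀ t₁ C C false (λ y y∈C → y∈C , contains-lookup C y i y∈C Cᵢ≡) (leaves-sound t₀ C)
... | just true  = LeafOf-node i t₀ t₁ C C true  (λ y y∈C → y∈C , contains-lookup C y i y∈C Cᵢ≡) (leaves-sound t₁ C)
... | nothing    = ++⁺ (LeafOf-node i t₀ t₁ C (C [ i ]≔ just false) false (fixed false)
                         (leaves-sound t₀ (C [ i ]≔ just false)))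
                       (LeafOf-node i t₀ t₁ C (C [ i ]≔ just true)  true  (fixed true)
                         (leaves-sound t₁ (C [ i ]≔ just true)))
  where
  fixed : ∀ b y → contains (C [ i ]≔ just b) y ≡ true → contains C y ≡ true × lookup y i ≡ b
  fixed b y y∈C′ = contains-fix⁻ C y i Cᵢ≡ y∈C′ , contains-lookup (C [ i ]≔ just b) y i y∈C′ (lookup∘update i C (just b))

leaves-cover : ∀ {n} (T : DTree n) C x → contains C x ≡ true → Any (λ ℓ → contains (proj₁ ℓ) x ≡ true) (leaves T C)
leaves-cover (leaf b)       C x x∈C = here x∈C
leaves-cover (node i t₀ t₁) C x x∈C with lookup C i in Cᵢ≡
... | just false = leaves-cover t₀ C x x∈C
... | just true  = leaves-cover t₁ C x x∈C
... | nothing with lookup x i in xᵢ≡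
...   | false = ++⁺ˡ (leaves-cover t₀ (C [ i ]≔ just false) x (contains-fix⁺ C x i Cᵢ≡ xᵢ≡ x∈C))
...   | true  = ++⁺ʳ (leaves t₀ (C [ i ]≔ just false))
                     (leaves-cover t₁ (C [ i ]≔ just true) x (contains-fix⁺ C x i Cᵢ≡ xᵢ≡ x∈C))

𝟙-differs≤hits : ∀ {n} (T : DTree n) C x R z (ℓ : Leaf n) → LeafOf T C ℓ → contains (proj₁ ℓ) x ≡ true →
  𝟙 (evalDT T x xor evalDT T (rerandomise R x z)) ≤ 𝟙 (contains (proj₁ ℓ) x) * fromℕ (hits R (proj₁ ℓ))
𝟙-differs≤hits T C x R z (D , b) ℓ-leaf x∈D rewrite x∈D with hits R D in hits≡
... | zero  = ℚP.≤-reflexive (begin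
  𝟙 (evalDT T x xor evalDT T y) ≡⟨ cong₂ (λ u v → 𝟙 (u xor v)) (proj₂ (ℓ-leaf x x∈D)) (proj₂ (ℓ-leaf y y∈D)) ⟩
  𝟙 (b xor b)                   ≡⟨ cong 𝟙 (xor-same b) ⟩
  0ℚ                            ≡⟨ ℚP.*-zeroʳ 1ℚ ⟨
  1ℚ * fromℕ 0                  ∎)
  where
  open ≡-Reasoning
  y = rerandomise R x z
  y∈D : contains D y ≡ true
  y∈D = contains-rerandomise R D x z hits≡ x∈D
... | suc k = begin
  𝟙 (evalDT T x xor evalDT T (rerandomise R x z)) ≤⟨ 𝟙≤1 _ ⟩
  fromℕ 1                                         ≤⟨ fromℕ-mono-≤ (ℕ.s≤s ℕ.z≤n) ⟩
  fromℕ (suc k)                                   ≡⟨ ℚP.*-identityˡ (fromℕ (suc k)) ⟨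
  1ℚ * fromℕ (suc k)                              ∎
  where open ℚP.≤-Reasoning

𝟙-differs≤∑hits : ∀ {n} (T : DTree n) x R z →
  𝟙 (evalDT T x xor evalDT T (rerandomise R x z)) ≤
  ∑ (leaves T (wholeCube n)) (λ ℓ → 𝟙 (contains (proj₁ ℓ) x) * fromℕ (hits R (proj₁ ℓ)))
𝟙-differs≤∑hits {n} T x R z =
  let ℓ , ℓ∈leaves , x∈ℓ = find (leaves-cover T (wholeCube n) x (contains-wholeCube x))
  in ℚP.≤-trans (𝟙-differs≤hits T (wholeCube n) x R z ℓ (All.lookup (leaves-sound T (wholeCube n)) ℓ∈leaves) x∈ℓ)
                (∈⇒≤∑ (λ ℓ → nonNeg-* (𝟙-nonNeg (contains (proj₁ ℓ) x)) (fromℕ-nonNeg (hits R (proj₁ ℓ)))) ℓ∈leaves)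

expectedHits : ∀ {n} → ℚ → List (Leaf n) → ℚ
expectedHits p ℓs = ∑ ℓs (λ ℓ → ½ ^ℚ codim (proj₁ ℓ) * (p * fromℕ (codim (proj₁ ℓ))))

NS-evalDT≤expectedHits : ∀ {n p} → 0ℚ ≤ p → p ≤ 1ℚ → (T : DTree n) →
  NS p (evalDT T) ≤ expectedHits p (leaves T (wholeCube n))
NS-evalDT≤expectedHits {n} {p} 0≤p p≤1 T = begin
  NS p (evalDT T)
    ≤⟨ 𝔼noise-mono-≤ 0≤p p≤1 (𝟙-differs≤∑hits T) ⟩
  𝔼noise n p (λ x R _ → ∑ L (λ ℓ → 𝟙 (contains (proj₁ ℓ) x) * fromℕ (hits R (proj₁ ℓ))))
    ≡⟨ 𝔼noise-∑ L (λ ℓ x R _ → 𝟙 (contains (proj₁ ℓ) x) * fromℕ (hits R (proj₁ ℓ))) ⟩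
  ∑ L (λ ℓ → 𝔼noise n p (λ x R _ → 𝟙 (contains (proj₁ ℓ) x) * fromℕ (hits R (proj₁ ℓ))))
    ≡⟨ ∑-cong L (λ ℓ → trans (𝔼noise-product (λ x → 𝟙 (contains (proj₁ ℓ) x)) (λ R → fromℕ (hits R (proj₁ ℓ))))
                             (cong₂ _*_ (𝔼-contains (proj₁ ℓ)) (∑-hits p (proj₁ ℓ)))) ⟩
  expectedHits p L ∎
  where
  open ℚP.≤-Reasoning
  L = leaves T (wholeCube n)

-- The leaf with subcube D is reached by 2 ^ dim D points, each after codim D distinct queries,
-- so this sums the path length over all points of the cube.
pathLengthSum : ∀ {n} → List (Leaf n) → ℕ
pathLengthSum ℓs = sum (map (λ ℓ → codim (proj₁ ℓ) ℕ.* 2 ℕ.^ dim (proj₁ ℓ)) ℓs)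

pathLengthSum-++ : ∀ {n} (ℓs ℓs′ : List (Leaf n)) → pathLengthSum (ℓs ++ ℓs′) ≡ pathLengthSum ℓs ℕ.+ pathLengthSum ℓs′
pathLengthSum-++ ℓs ℓs′ = trans (cong sum (map-++ _ ℓs ℓs′)) (sum-++ (map _ ℓs) _)

private
  4ab≤[a+b]²-ordered : ∀ {a b} → a ℕ.≤ b → 4 ℕ.* (a ℕ.* b) ℕ.≤ (a ℕ.+ b) ℕ.* (a ℕ.+ b)
  4ab≤[a+b]²-ordered {a} a≤b with ℕP.m≤n⇒∃[o]m+o≡n a≤b
  ... | d , refl = ℕP.≤-trans (ℕP.m≤m+n _ (d ℕ.* d)) (ℕP.≤-reflexive (expand a d))
    where
    expand : ∀ a d → 4 ℕ.* (a ℕ.* (a ℕ.+ d)) ℕ.+ d ℕ.* d ≡ (a ℕ.+ (a ℕ.+ d)) ℕ.* (a ℕ.+ (a ℕ.+ d))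
    expand = solve-∀

4ab≤[a+b]² : ∀ a b → 4 ℕ.* (a ℕ.* b) ℕ.≤ (a ℕ.+ b) ℕ.* (a ℕ.+ b)
4ab≤[a+b]² a b with ℕP.≤-total a b
... | inj₁ a≤b = 4ab≤[a+b]²-ordered a≤b
... | inj₂ b≤a = subst₂ (λ u v → 4 ℕ.* u ℕ.≤ v ℕ.* v) (ℕP.*-comm b a) (ℕP.+-comm b a) (4ab≤[a+b]²-ordered b≤a)

^-distribʳ-* : ∀ a b m → (a ℕ.* b) ℕ.^ m ≡ a ℕ.^ m ℕ.* b ℕ.^ m
^-distribʳ-* a b zero    = refl
^-distribʳ-* a b (suc m) = trans (cong ((a ℕ.* b) ℕ.*_) (^-distribʳ-* a b m)) (ℕ*.interchange a b (a ℕ.^ m) (b ℕ.^ m))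

halves≤whole : ∀ x a b → (2 ℕ.* x ℕ.* a) ℕ.* (2 ℕ.* x ℕ.* b) ℕ.≤ (x ℕ.* (a ℕ.+ b)) ℕ.* (x ℕ.* (a ℕ.+ b))
halves≤whole x a b = begin
  (2 ℕ.* x ℕ.* a) ℕ.* (2 ℕ.* x ℕ.* b)   ≡⟨ gather x a b ⟩
  (x ℕ.* x) ℕ.* (4 ℕ.* (a ℕ.* b))         ≤⟨ ℕP.*-monoʳ-≤ (x ℕ.* x) (4ab≤[a+b]² a b) ⟩
  (x ℕ.* x) ℕ.* ((a ℕ.+ b) ℕ.* (a ℕ.+ b)) ≡⟨ ℕ*.interchange x x (a ℕ.+ b) (a ℕ.+ b) ⟩
  (x ℕ.* (a ℕ.+ b)) ℕ.* (x ℕ.* (a ℕ.+ b)) ∎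
  where
  open ℕP.≤-Reasoning
  gather : ∀ x a b → (2 ℕ.* x ℕ.* a) ℕ.* (2 ℕ.* x ℕ.* b) ≡ (x ℕ.* x) ℕ.* (4 ℕ.* (a ℕ.* b))
  gather = solve-∀

2^pathLengthSum≤ : ∀ {n} (T : DTree n) C →
  2 ℕ.^ pathLengthSum (leaves T C) ℕ.≤ (2 ℕ.^ codim C ℕ.* size T) ℕ.^ (2 ℕ.^ dim C)
2^pathLengthSum≤ (leaf b) C = ℕP.≤-reflexive (begin
  2 ℕ.^ (codim C ℕ.* 2 ℕ.^ dim C ℕ.+ 0)   ≡⟨ cong (2 ℕ.^_) (ℕP.+-identityʳ (codim C ℕ.* 2 ℕ.^ dim C)) ⟩
  2 ℕ.^ (codim C ℕ.* 2 ℕ.^ dim C)         ≡⟨ ℕP.^-*-assoc 2 (codim C) (2 ℕ.^ dim C) ⟨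
  (2 ℕ.^ codim C) ℕ.^ (2 ℕ.^ dim C)       ≡⟨ cong (ℕ._^ (2 ℕ.^ dim C)) (ℕP.*-identityʳ (2 ℕ.^ codim C)) ⟨
  (2 ℕ.^ codim C ℕ.* 1) ℕ.^ (2 ℕ.^ dim C) ∎)
  where open ≡-Reasoning
2^pathLengthSum≤ (node i t₀ t₁) C with lookup C i in Cᵢ≡
... | just false = ℕP.≤-trans (2^pathLengthSum≤ t₀ C)
                     (ℕP.^-monoˡ-≤ (2 ℕ.^ dim C) (ℕP.*-monoʳ-≤ (2 ℕ.^ codim C) (ℕP.m≤m+n (size t₀) (size t₁))))
... | just true  = ℕP.≤-trans (2^pathLengthSum≤ t₁ C)
                     (ℕP.^-monoˡ-≤ (2 ℕ.^ dim C) (ℕP.*-monoʳ-≤ (2 ℕ.^ codim C) (ℕP.m≤n+m (size t₁) (size t₀))))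
... | nothing    = begin
  2 ℕ.^ pathLengthSum (leaves t₀ C₀ ++ leaves t₁ C₁)
    ≡⟨ cong (2 ℕ.^_) (pathLengthSum-++ (leaves t₀ C₀) (leaves t₁ C₁)) ⟩
  2 ℕ.^ (pathLengthSum (leaves t₀ C₀) ℕ.+ pathLengthSum (leaves t₁ C₁))
    ≡⟨ ℕP.^-distribˡ-+-* 2 (pathLengthSum (leaves t₀ C₀)) (pathLengthSum (leaves t₁ C₁)) ⟩
  2 ℕ.^ pathLengthSum (leaves t₀ C₀) ℕ.* 2 ℕ.^ pathLengthSum (leaves t₁ C₁)
    ≤⟨ ℕP.*-mono-≤ (2^pathLengthSum≤ t₀ C₀) (2^pathLengthSum≤ t₁ C₁) ⟩
  (2 ℕ.^ codim C₀ ℕ.* s₀) ℕ.^ (2 ℕ.^ dim C₀) ℕ.* (2 ℕ.^ codim C₁ ℕ.* s₁) ℕ.^ (2 ℕ.^ dim C₁)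
    ≡⟨ cong₂ (λ u v → (2 ℕ.^ u ℕ.* s₀) ℕ.^ (2 ℕ.^ g) ℕ.* (2 ℕ.^ v ℕ.* s₁) ℕ.^ (2 ℕ.^ dim C₁))
             (codim-fix C i false Cᵢ≡) (codim-fix C i true Cᵢ≡) ⟩
  (2 ℕ.* x ℕ.* s₀) ℕ.^ (2 ℕ.^ g) ℕ.* (2 ℕ.* x ℕ.* s₁) ℕ.^ (2 ℕ.^ dim C₁)
    ≡⟨ cong (λ v → (2 ℕ.* x ℕ.* s₀) ℕ.^ (2 ℕ.^ g) ℕ.* (2 ℕ.* x ℕ.* s₁) ℕ.^ (2 ℕ.^ v))
            (ℕP.suc-injective (trans (sym (dim-fix C i true Cᵢ≡)) (dim-fix C i false Cᵢ≡))) ⟩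
  (2 ℕ.* x ℕ.* s₀) ℕ.^ (2 ℕ.^ g) ℕ.* (2 ℕ.* x ℕ.* s₁) ℕ.^ (2 ℕ.^ g)
    ≡⟨ ^-distribʳ-* (2 ℕ.* x ℕ.* s₀) (2 ℕ.* x ℕ.* s₁) (2 ℕ.^ g) ⟨
  ((2 ℕ.* x ℕ.* s₀) ℕ.* (2 ℕ.* x ℕ.* s₁)) ℕ.^ (2 ℕ.^ g)
    ≤⟨ ℕP.^-monoˡ-≤ (2 ℕ.^ g) (halves≤whole x s₀ s₁) ⟩
  ((x ℕ.* (s₀ ℕ.+ s₁)) ℕ.* (x ℕ.* (s₀ ℕ.+ s₁))) ℕ.^ (2 ℕ.^ g)
    ≡⟨ cong (ℕ._^ (2 ℕ.^ g)) (cong ((x ℕ.* (s₀ ℕ.+ s₁)) ℕ.*_) (ℕP.*-identityʳ (x ℕ.* (s₀ ℕ.+ s₁)))) ⟨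
  ((x ℕ.* (s₀ ℕ.+ s₁)) ℕ.^ 2) ℕ.^ (2 ℕ.^ g)
    ≡⟨ ℕP.^-*-assoc (x ℕ.* (s₀ ℕ.+ s₁)) 2 (2 ℕ.^ g) ⟩
  (x ℕ.* (s₀ ℕ.+ s₁)) ℕ.^ (2 ℕ.^ suc g)
    ≡⟨ cong (λ v → (x ℕ.* (s₀ ℕ.+ s₁)) ℕ.^ (2 ℕ.^ v)) (dim-fix C i false Cᵢ≡) ⟨
  (2 ℕ.^ codim C ℕ.* (s₀ ℕ.+ s₁)) ℕ.^ (2 ℕ.^ dim C) ∎
  where
  open ℕP.≤-Reasoning
  C₀ = C [ i ]≔ just false
  C₁ = C [ i ]≔ just true
  s₀ = size t₀
  s₁ = size t₁
  x = 2 ℕ.^ codim C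
  g = dim C₀

2^pathLengthSum≤size^2ⁿ : ∀ {n} (T : DTree n) → 2 ℕ.^ pathLengthSum (leaves T (wholeCube n)) ℕ.≤ size T ℕ.^ (2 ℕ.^ n)
2^pathLengthSum≤size^2ⁿ {n} T = begin
  2 ℕ.^ pathLengthSum (leaves T (wholeCube n))                          ≤⟨ 2^pathLengthSum≤ T (wholeCube n) ⟩
  (2 ℕ.^ codim (wholeCube n) ℕ.* size T) ℕ.^ (2 ℕ.^ dim (wholeCube n))  ≡⟨ cong₂ (λ k d → (2 ℕ.^ k ℕ.* size T) ℕ.^ (2 ℕ.^ d))
                                                                              (codim-wholeCube n) (dim-wholeCube n) ⟩
  (1 ℕ.* size T) ℕ.^ (2 ℕ.^ n)                                          ≡⟨ cong (ℕ._^ (2 ℕ.^ n)) (ℕP.*-identityˡ (size T)) ⟩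
  size T ℕ.^ (2 ℕ.^ n)                                                  ∎
  where open ℕP.≤-Reasoning

expectedHits-scaled : ∀ {n} p (ℓs : List (Leaf n)) →
  expectedHits p ℓs * fromℕ (2 ℕ.^ n) ≡ p * fromℕ (pathLengthSum ℓs)
expectedHits-scaled {n} p []       = trans (ℚP.*-zeroˡ (fromℕ (2 ℕ.^ n))) (sym (ℚP.*-zeroʳ p))
expectedHits-scaled {n} p (ℓ ∷ ℓs) = begin
  (term + expectedHits p ℓs) * N              ≡⟨ ℚP.*-distribʳ-+ N term (expectedHits p ℓs) ⟩
  term * N + expectedHits p ℓs * N            ≡⟨ cong₂ _+_ (leaf-scaled (proj₁ ℓ)) (expectedHits-scaled p ℓs) ⟩
  p * fromℕ m + p * fromℕ (pathLengthSum ℓs) ≡⟨ ℚP.*-distribˡ-+ p (fromℕ m) _ ⟨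
  p * (fromℕ m + fromℕ (pathLengthSum ℓs)) ≡⟨ cong (p *_) (fromℕ-+ m (pathLengthSum ℓs)) ⟨
  p * fromℕ (pathLengthSum (ℓ ∷ ℓs))       ∎
  where
  open ≡-Reasoning
  N = fromℕ (2 ℕ.^ n)
  term = ½ ^ℚ codim (proj₁ ℓ) * (p * fromℕ (codim (proj₁ ℓ)))
  m = codim (proj₁ ℓ) ℕ.* 2 ℕ.^ dim (proj₁ ℓ)
  leaf-scaled : (D : Subcube n) → ½ ^ℚ codim D * (p * fromℕ (codim D)) * N ≡ p * fromℕ (codim D ℕ.* 2 ℕ.^ dim D)
  leaf-scaled D = begin
    ½ ^ℚ k * (p * fromℕ k) * fromℕ (2 ℕ.^ n)
      ≡⟨ cong (λ e → ½ ^ℚ k * (p * fromℕ k) * fromℕ (2 ℕ.^ e)) (codim+dim≡n D) ⟨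
    ½ ^ℚ k * (p * fromℕ k) * fromℕ (2 ℕ.^ (k ℕ.+ d))
      ≡⟨ cong (λ e → ½ ^ℚ k * (p * fromℕ k) * e)
              (trans (cong fromℕ (ℕP.^-distribˡ-+-* 2 k d)) (fromℕ-* (2 ℕ.^ k) (2 ℕ.^ d))) ⟩
    ½ ^ℚ k * (p * fromℕ k) * (fromℕ (2 ℕ.^ k) * fromℕ (2 ℕ.^ d))
      ≡⟨ *.interchange (½ ^ℚ k) (p * fromℕ k) (fromℕ (2 ℕ.^ k)) (fromℕ (2 ℕ.^ d)) ⟩
    ½ ^ℚ k * fromℕ (2 ℕ.^ k) * (p * fromℕ k * fromℕ (2 ℕ.^ d))
      ≡⟨ cong₂ _*_ (½^k*2^k k) (ℚP.*-assoc p (fromℕ k) (fromℕ (2 ℕ.^ d))) ⟩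
    1ℚ * (p * (fromℕ k * fromℕ (2 ℕ.^ d)))
      ≡⟨ ℚP.*-identityˡ _ ⟩
    p * (fromℕ k * fromℕ (2 ℕ.^ d))
      ≡⟨ cong (p *_) (fromℕ-* k (2 ℕ.^ d)) ⟨
    p * fromℕ (k ℕ.* 2 ℕ.^ d) ∎
    where
    k = codim D
    d = dim D

^-cancelʳ-≤ : ∀ {x y} N .{{_ : ℕ.NonZero N}} → x ℕ.^ N ℕ.≤ y ℕ.^ N → x ℕ.≤ y
^-cancelʳ-≤ {x} {y} N xᴺ≤yᴺ with x ℕ.≤? y
... | yes x≤y = x≤y
... | no  x≰y = contradiction xᴺ≤yᴺ (ℕP.<⇒≱ (ℕP.^-monoˡ-< N (ℕP.≰⇒> x≰y)))

0<⇒↥≡+ : ∀ {a} → 0ℚ < a → ∃ λ m → ↥ a ≡ ℤ.+ m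
0<⇒↥≡+ {mkℚ (ℤ.+ m)    _ _} _ = m , refl
0<⇒↥≡+ {mkℚ ℤ.-[1+ _ ] _ _} (ℚ.*<* ())

cross-multiply : ∀ {a p : ℚ} {m k} N E → ↥ a ≡ ℤ.+ m → ↥ p ≡ ℤ.+ k →
  a * fromℕ N ≤ p * fromℕ E → m ℕ.* ↧ₙ p ℕ.* N ℕ.≤ k ℕ.* (E ℕ.* ↧ₙ a)
cross-multiply {a} {p} {m} {k} N E ↥a≡m ↥p≡k aN≤pE = fromℕ-cancel-≤ (begin
  fromℕ (m ℕ.* pd ℕ.* N)               ≡⟨ trans (fromℕ-* (m ℕ.* pd) N) (cong (_* fromℕ N) (fromℕ-* m pd)) ⟩
  fromℕ m * fromℕ pd * fromℕ N         ≡⟨ cong (λ e → e * fromℕ pd * fromℕ N) (*↧ₙ≡↥ a ↥a≡m) ⟨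
  a * fromℕ d * fromℕ pd * fromℕ N     ≡⟨ solve 4 (λ a d q n → a :* d :* q :* n := (a :* n) :* (d :* q)) refl
                                                   a (fromℕ d) (fromℕ pd) (fromℕ N) ⟩
  (a * fromℕ N) * (fromℕ d * fromℕ pd) ≤⟨ ℚP.*-monoʳ-≤-nonNeg (fromℕ d * fromℕ pd)
                                             {{ℚ.nonNegative (nonNeg-* (fromℕ-nonNeg d) (fromℕ-nonNeg pd))}} aN≤pE ⟩
  (p * fromℕ E) * (fromℕ d * fromℕ pd) ≡⟨ solve 4 (λ p e d q → (p :* e) :* (d :* q) := (p :* q) :* (e :* d)) refl
                                                   p (fromℕ E) (fromℕ d) (fromℕ pd) ⟩
  (p * fromℕ pd) * (fromℕ E * fromℕ d) ≡⟨ cong₂ _*_ (*↧ₙ≡↥ p ↥p≡k) (sym (fromℕ-* E d)) ⟩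
  fromℕ k * fromℕ (E ℕ.* d)            ≡⟨ fromℕ-* k (E ℕ.* d) ⟨
  fromℕ (k ℕ.* (E ℕ.* d))              ∎)
  where
  open ℚP.≤-Reasoning
  d = ↧ₙ a
  pd = ↧ₙ p

≤·log₂-intro : ∀ {a p : ℚ} {s} N E .{{_ : ℕ.NonZero N}} → 0ℚ < a → 0ℚ < p →
  a * fromℕ N ≤ p * fromℕ E → 2 ℕ.^ E ℕ.≤ s ℕ.^ N → a ≤ p ·log₂ s
≤·log₂-intro {a} {p} {s} N E 0<a 0<p aN≤pE 2ᴱ≤sᴺ with 0<⇒↥≡+ 0<a | 0<⇒↥≡+ 0<p
... | m , ↥a≡m | k , ↥p≡k rewrite ↥p≡k = inj₂ (m , ↥a≡m , ^-cancelʳ-≤ N (begin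
  (2 ℕ.^ (m ℕ.* ↧ₙ p)) ℕ.^ N   ≡⟨ ℕP.^-*-assoc 2 (m ℕ.* ↧ₙ p) N ⟩
  2 ℕ.^ (m ℕ.* ↧ₙ p ℕ.* N)     ≤⟨ ℕP.^-monoʳ-≤ 2 (cross-multiply {a} {p} N E ↥a≡m ↥p≡k aN≤pE) ⟩
  2 ℕ.^ (k ℕ.* (E ℕ.* d))      ≡⟨ cong (2 ℕ.^_) (reorder k E d) ⟩
  2 ℕ.^ (E ℕ.* (d ℕ.* k))      ≡⟨ ℕP.^-*-assoc 2 E (d ℕ.* k) ⟨
  (2 ℕ.^ E) ℕ.^ (d ℕ.* k)      ≤⟨ ℕP.^-monoˡ-≤ (d ℕ.* k) 2ᴱ≤sᴺ ⟩
  (s ℕ.^ N) ℕ.^ (d ℕ.* k)      ≡⟨ ℕP.^-*-assoc s N (d ℕ.* k) ⟩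
  s ℕ.^ (N ℕ.* (d ℕ.* k))      ≡⟨ cong (s ℕ.^_) (ℕP.*-comm N (d ℕ.* k)) ⟩
  s ℕ.^ (d ℕ.* k ℕ.* N)        ≡⟨ ℕP.^-*-assoc s (d ℕ.* k) N ⟨
  (s ℕ.^ (d ℕ.* k)) ℕ.^ N      ∎))
  where
  open ℕP.≤-Reasoning
  d = ↧ₙ a
  reorder : ∀ k E d → k ℕ.* (E ℕ.* d) ≡ E ℕ.* (d ℕ.* k)
  reorder = solve-∀

proposition3p2 : (n : ℕ) (f : Cube n → Bool) (T : DTree n) (s : ℕ) (opt : ℚ) →
    size T ≡ s → dist f (evalDT T) ≤ opt →
    (p : ℚ) → 0ℚ < p → p < 1ℚ →
    (NS p f - (opt + opt)) ≤ p ·log₂ s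
proposition3p2 n f T s opt refl dist≤opt p 0<p p<1 with NS p f - (opt + opt) ℚP.≤? 0ℚ
... | yes ≤0 = inj₁ ≤0
... | no  ≰0 = ≤·log₂-intro (2 ℕ.^ n) (pathLengthSum L) {{ℕP.m^n≢0 2 n}} (ℚP.≰⇒> ≰0) 0<p
                 scaled (2^pathLengthSum≤size^2ⁿ T)
  where
  open ℚP.≤-Reasoning
  0≤p = ℚP.<⇒≤ 0<p
  p≤1 = ℚP.<⇒≤ p<1
  L = leaves T (wholeCube n)
  NS≤ : NS p f ≤ opt + (expectedHits p L + opt)
  NS≤ = begin
    NS p f                                                    ≤⟨ NS-triangle 0≤p p≤1 f (evalDT T) ⟩
    dist f (evalDT T) + (NS p (evalDT T) + dist f (evalDT T)) ≤⟨ ℚP.+-mono-≤ dist≤opt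
                                                                    (ℚP.+-mono-≤ (NS-evalDT≤expectedHits 0≤p p≤1 T) dist≤opt) ⟩
    opt + (expectedHits p L + opt)                            ∎
  scaled : (NS p f - (opt + opt)) * fromℕ (2 ℕ.^ n) ≤ p * fromℕ (pathLengthSum L)
  scaled = begin
    (NS p f - (opt + opt)) * fromℕ (2 ℕ.^ n)
      ≤⟨ ℚP.*-monoʳ-≤-nonNeg (fromℕ (2 ℕ.^ n)) (ℚP.+-monoˡ-≤ (ℚ.- (opt + opt)) NS≤) ⟩
    (opt + (expectedHits p L + opt) - (opt + opt)) * fromℕ (2 ℕ.^ n)
      ≡⟨ cong (_* fromℕ (2 ℕ.^ n)) (solve 2 (λ o b → o :+ (b :+ o) :- (o :+ o) := b) refl opt (expectedHits p L)) ⟩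
    expectedHits p L * fromℕ (2 ℕ.^ n)
      ≡⟨ expectedHits-scaled p L ⟩
    p * fromℕ (pathLengthSum L) ∎
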